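{- The class of all irreflexive symmetric frames with at least $2$ elements is relatively elementary definable in $\mathcal{K}_2$.
   Context: A frame is a pair $(W,R)$ with $W$ non-empty and $R\subseteq W\times W$. For sets $A,B$ with $A\cap B=\emptyset$, $A\cup B\neq\emptyset$, and a function $\rho:A\to\mathcal{P}(B)$, the galaxy $\mathcal{F}^\rho_{A,B}$ is the frame with universe $A\cup B$ and relation $\bigcup_{s\in A}(\{s\}\times\rho(s))\cup(B\times B)$. $\mathcal{K}_2$ is the class of all galaxies $\mathcal{F}^\rho_{A,B}$ with $|A|\geq4$, $|B|\geq4$ and $|\rho(s)|=2$ for all $s\in A$. First-order formulas use equality and one binary relation symbol $\mathbf{R}$. A class $\mathcal{C}$ of frames is relatively elementary definable in a class $\mathcal{C}'$ of frames if there are first-order formulas $\mathbf{U}(\mathbf{x_1},\mathbf{x_2})$, $\mathbf{E}(\mathbf{x_1},\mathbf{x_2},\mathbf{y_1},\mathbf{y_2})$ and $\mathbf{A}(\mathbf{x_1},\mathbf{x_2},\mathbf{y_1},\mathbf{y_2})$ such that for every frame $(W,R)$ in $\mathcal{C}$ there is a frame $(W',R')$ in $\mathcal{C}'$ such that, letting $X=\{(s_1,s_2)\in W'^2:(W',R')\models\mathbf{U}[s_1,s_2]\}$, $\eta=\{((s_1,s_2),(t_1,t_2))\in X^2:(W',R')\models\mathbf{E}[s_1,s_2,t_1,t_2]\}$ and $S=\{((s_1,s_2),(t_1,t_2))\in X^2:(W',R')\models\mathbf{A}[s_1,s_2,t_1,t_2]\}$: $X$ is non-empty, $\eta$ is an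 equivalence relation on $X$ which is a congruence for $S$ (i.e. if $a\,\eta\, c$ and $b\,\eta\, d$ then $aSb$ iff $cSd$), and the quotient $(X,S)/\eta$ is isomorphic to $(W,R)$. -}

module Defs where

open import Data.Nat using (ℕ; suc)
open import Data.Fin using (Fin; zero; suc)
open import Data.Product using (Σ; _×_; _,_; ∃)
open import Data.Sum using (_⊎_; inj₁; inj₂)
open import Data.Empty using (⊥)
open import Data.Unit using (⊤)
open import Relation.Nullary using (¬_)
open import Relation.Binary.PropositionalEquality using (_≡_)

-- Frames: a non-empty carrier W with a binary relation R ⊆ W × W.
-- (Non-emptiness is stated separately where needed.)

record Frame : Set₁ where
  field
    W : Set
    R : W → W → Set

-- First-order formulas in the language {=, R}, with variables
-- scoped by de Bruijn indices in Fin n.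

infixr 6 _∧'_
infixr 5 _∨'_
infixr 4 _⇒'_

data Formula : ℕ → Set where
  _≐_  : ∀ {n} → Fin n → Fin n → Formula n
  Rel  : ∀ {n} → Fin n → Fin n → Formula n
  ⊥'   : ∀ {n} → Formula n
  ¬'_  : ∀ {n} → Formula n → Formula n
  _∧'_ : ∀ {n} → Formula n → Formula n → Formula n
  _∨'_ : ∀ {n} → Formula n → Formula n → Formula n
  _⇒'_ : ∀ {n} → Formula n → Formula n → Formula n
  ∀'   : ∀ {n} → Formula (suc n) → Formula n
  ∃'   : ∀ {n} → Formula (suc n) → Formula n

_∷ᵥ_ : ∀ {n} {W : Set} → W → (Fin n → W) → Fin (suc n) → W
(w ∷ᵥ v) zero    = w
(w ∷ᵥ v) (suc i) = v i

Sat : (F : Frame) → ∀ {n} → Formula n → (Fin n → Frame.W F) → Set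
Sat F (i ≐ j)  v = v i ≡ v j
Sat F (Rel i j) v = Frame.R F (v i) (v j)
Sat F ⊥'       v = ⊥
Sat F (¬' φ)   v = ¬ Sat F φ v
Sat F (φ ∧' ψ) v = Sat F φ v × Sat F ψ v
Sat F (φ ∨' ψ) v = Sat F φ v ⊎ Sat F ψ v
Sat F (φ ⇒' ψ) v = Sat F φ v → Sat F ψ v
Sat F (∀' φ)   v = (w : Frame.W F) → Sat F φ (w ∷ᵥ v)
Sat F (∃' φ)   v = Σ (Frame.W F) λ w → Sat F φ (w ∷ᵥ v)

val2 : {W : Set} → W → W → Fin 2 → W
val2 a b zero       = a
val2 a b (suc zero) = b

val4 : {W : Set} → W → W → W → W → Fin 4 → W
val4 a b c d zero                   = a
val4 a b c d (suc zero)             = b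
val4 a b c d (suc (suc zero))       = c
val4 a b c d (suc (suc (suc zero))) = d

AtLeast : ℕ → Set → Set
AtLeast k X = Σ (Fin k → X) Injective'
  where
  Injective' : (Fin k → X) → Set
  Injective' f = ∀ i j → f i ≡ f j → i ≡ j

HasExactlyTwo : {B : Set} → (B → Set) → Set
HasExactlyTwo {B} P =
  Σ B λ b₁ → Σ B λ b₂ →
    ¬ (b₁ ≡ b₂) × P b₁ × P b₂ × (∀ b → P b → b ≡ b₁ ⊎ b ≡ b₂)

-- Galaxies  F^ρ_{A,B}:  universe A ⊎ B (disjoint union), relation
--   ⋃_{s ∈ A} {s} × ρ(s)  ∪  B × B.

GalaxyR : (A B : Set) → (A → B → Set) → A ⊎ B → A ⊎ B → Set
GalaxyR A B ρ (inj₁ s) (inj₁ t) = ⊥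
GalaxyR A B ρ (inj₁ s) (inj₂ b) = ρ s b
GalaxyR A B ρ (inj₂ b) (inj₁ t) = ⊥
GalaxyR A B ρ (inj₂ b) (inj₂ c) = ⊤

Galaxy : (A B : Set) → (A → B → Set) → Frame
Galaxy A B ρ = record { W = A ⊎ B ; R = GalaxyR A B ρ }

InK₂ : (A B : Set) → (A → B → Set) → Set
InK₂ A B ρ = AtLeast 4 A × AtLeast 4 B × (∀ s → HasExactlyTwo (ρ s))

IrreflSymm2 : Frame → Set
IrreflSymm2 F =
  (∀ x → ¬ R x x) × (∀ x y → R x y → R y x) × AtLeast 2 W
  where open Frame F

-- Interpretation data: given U, E, A-formulas, the frame F' interprets F
-- when X = U^{F'} is non-empty, η = E^{F'} restricted to X is an
-- equivalence relation on X, a congruence for S = A^{F'} on X, and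
-- (X,S)/η ≅ (W,R).  Since Agda has no quotient types, the last clause is
-- rendered as: there is a surjection f : X → W whose kernel is exactly η
-- and with  S a b ⇔ R (f a) (f b)  (this is precisely an isomorphism
-- (X,S)/η ≅ (W,R) composed with the quotient map).

Interprets : Formula 2 → Formula 4 → Formula 4 → Frame → Frame → Set
Interprets U E A F' F =
  let W' = Frame.W F'
      X  = Σ (W' × W') λ { (s₁ , s₂) → Sat F' U (val2 s₁ s₂) }
      η : X → X → Set
      η = λ { ((s₁ , s₂) , _) ((t₁ , t₂) , _) → Sat F' E (val4 s₁ s₂ t₁ t₂) }
      S : X → X → Set
      S = λ { ((s₁ , s₂) , _) ((t₁ , t₂) , _) → Sat F' A (val4 s₁ s₂ t₁ t₂) }
  in  X
    × (∀ a → η a a)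
    × (∀ a b → η a b → η b a)
    × (∀ a b c → η a b → η b c → η a c)
    × (∀ a b c d → η a c → η b d → (S a b → S c d) × (S c d → S a b))
    × Σ (X → Frame.W F) λ f →
        (∀ w → Σ X λ a → f a ≡ w)
      × (∀ a b → (η a b → f a ≡ f b) × (f a ≡ f b → η a b))
      × (∀ a b → (S a b → Frame.R F (f a) (f b)) × (Frame.R F (f a) (f b) → S a b))

RelElemDefInK₂ : (Frame → Set) → Set₁
RelElemDefInK₂ C =
  Σ (Formula 2) λ U → Σ (Formula 4) λ E → Σ (Formula 4) λ A →
    ∀ (F : Frame) → C F →
      Σ Set λ A' → Σ Set λ B' → Σ (A' → B' → Set) λ ρ →
        InK₂ A' B' ρ × Interprets U E A (Galaxy A' B' ρ) F

{-# OPTIONS --safe #-}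

-- Turn an irreflexive symmetric frame (W, R) into a galaxy: B consists of two
-- copies (w, false), (w, true) of every world w; A has vertex nodes seeing both
-- copies of w, and for every edge x R y an edge node seeing (x, false) and
-- (y, false), which are distinct by irreflexivity. A world is coded by the pair
-- of its two copies. These pairs are first-order recognisable: they have a common
-- irreflexive predecessor, and every predecessor of (w, true) is one of (w, false),
-- whereas the endpoints of an edge are separated by their vertex nodes. Two codes
-- denote the same world iff they share a point, and u R v iff some node sees
-- distinct points of the codes of u and v without seeing both copies of u, which
-- singles out the edge nodes.

module Submission where

open import Defs
open import Data.Bool using (Bool; false; true)
open import Data.Empty using (⊥-elim)
open import Data.Fin using (Fin; #_)
open import Data.Fin.Properties using (2↔Bool; *↔×)
open import Data.Nat using (ℕ; _*_)
open import Data.Product using (Σ; ∃; _×_; _,_; proj₁; proj₂)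
open import Data.Product.Function.NonDependent.Propositional using (_×-↣_)
open import Data.Sum using (_⊎_; inj₁; inj₂; [_,_])
open import Data.Unit using (tt)
open import Function using (_∘_)
open import Function.Bundles using (_↣_; _⇔_; Injection; Equivalence; mk↣; mk⇔)
open import Function.Construct.Composition using (_↣-∘_)
open import Function.Properties.Inverse using (↔⇒↣)
open import Relation.Nullary using (¬_)
open import Relation.Binary.PropositionalEquality
  using (_≡_; _≢_; refl; sym; trans; cong; subst₂)

private variable
  k m n : ℕ
  X Y : Set

↣⇒AtLeast : Fin k ↣ X → AtLeast k X
↣⇒AtLeast f = to , λ _ _ → injective
  where open Injection f

AtLeast⇒↣ : AtLeast k X → Fin k ↣ X
AtLeast⇒↣ (f , f-injective) = mk↣ (f-injective _ _)

AtLeast-map : X ↣ Y → AtLeast k X → AtLeast k Y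
AtLeast-map f = ↣⇒AtLeast ∘ (f ↣-∘_) ∘ AtLeast⇒↣

AtLeast-× : AtLeast m X → AtLeast n Y → AtLeast (m * n) (X × Y)
AtLeast-× {m} {n = n} a b =
  ↣⇒AtLeast ((AtLeast⇒↣ a ×-↣ AtLeast⇒↣ b) ↣-∘ ↔⇒↣ (*↔× {m} {n}))

AtLeast-2-Bool : AtLeast 2 Bool
AtLeast-2-Bool = ↣⇒AtLeast (↔⇒↣ 2↔Bool)

distinct-Bools-cover : ∀ {k k' : Bool} → k ≢ k' → ∀ b → b ≡ k ⊎ b ≡ k'
distinct-Bools-cover {false} {false} k≢k' _ = ⊥-elim (k≢k' refl)
distinct-Bools-cover {true}  {true}  k≢k' _ = ⊥-elim (k≢k' refl)
distinct-Bools-cover {false} {true}  _ false = inj₁ refl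
distinct-Bools-cover {false} {true}  _ true  = inj₂ refl
distinct-Bools-cover {true}  {false} _ false = inj₂ refl
distinct-Bools-cover {true}  {false} _ true  = inj₁ refl

record Coding (U : Formula 2) (E A : Formula 4) (F′ F : Frame) : Set₁ where
  field
    Codes      : Frame.W F → Frame.W F′ → Frame.W F′ → Set
    code       : ∀ u → ∃ λ x₁ → ∃ λ x₂ → Codes u x₁ x₂
    U-sound    : ∀ x₁ x₂ → Sat F′ U (val2 x₁ x₂) → ∃ λ u → Codes u x₁ x₂
    U-complete : ∀ {u x₁ x₂} → Codes u x₁ x₂ → Sat F′ U (val2 x₁ x₂)
    E-correct  : ∀ {u v x₁ x₂ y₁ y₂} → Codes u x₁ x₂ → Codes v y₁ y₂ →
                 Sat F′ E (val4 x₁ x₂ y₁ y₂) ⇔ u ≡ v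
    A-correct  : ∀ {u v x₁ x₂ y₁ y₂} → Codes u x₁ x₂ → Codes v y₁ y₂ →
                 Sat F′ A (val4 x₁ x₂ y₁ y₂) ⇔ Frame.R F u v

Coding⇒Interprets : ∀ {U E A F′ F} → Frame.W F → Coding U E A F′ F → Interprets U E A F′ F
Coding⇒Interprets {U} {E} {A} {F′} {F} w₀ coding =
  proj₁ (decode-surjective w₀) , ≈-refl , ≈-sym , ≈-trans ,
  (λ a b c d a≈c b≈d →
     ∼-resp-≈ a b c d a≈c b≈d , ∼-resp-≈ c d a b (≈-sym a c a≈c) (≈-sym b d b≈d)) ,
  decode , decode-surjective ,
  (λ a b → to (kernel a b) , from (kernel a b)) ,
  (λ a b → to (related a b) , from (related a b))
  where
  open Coding coding
  open Frame F
  open Equivalence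

  Dom : Set
  Dom = Σ (Frame.W F′ × Frame.W F′) λ (x₁ , x₂) → Sat F′ U (val2 x₁ x₂)

  decode : Dom → W
  decode ((x₁ , x₂) , ux) = proj₁ (U-sound x₁ x₂ ux)

  decode-codes : ∀ a → Codes (decode a) (proj₁ (proj₁ a)) (proj₂ (proj₁ a))
  decode-codes ((x₁ , x₂) , ux) = proj₂ (U-sound x₁ x₂ ux)

  _≈_ _∼_ : Dom → Dom → Set
  ((x₁ , x₂) , _) ≈ ((y₁ , y₂) , _) = Sat F′ E (val4 x₁ x₂ y₁ y₂)
  ((x₁ , x₂) , _) ∼ ((y₁ , y₂) , _) = Sat F′ A (val4 x₁ x₂ y₁ y₂)

  kernel : ∀ a b → a ≈ b ⇔ decode a ≡ decode b
  kernel a b = E-correct (decode-codes a) (decode-codes b)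

  related : ∀ a b → a ∼ b ⇔ R (decode a) (decode b)
  related a b = A-correct (decode-codes a) (decode-codes b)

  ≈-refl : ∀ a → a ≈ a
  ≈-refl a = from (kernel a a) refl

  ≈-sym : ∀ a b → a ≈ b → b ≈ a
  ≈-sym a b = from (kernel b a) ∘ sym ∘ to (kernel a b)

  ≈-trans : ∀ a b c → a ≈ b → b ≈ c → a ≈ c
  ≈-trans a b c a≈b b≈c = from (kernel a c) (trans (to (kernel a b) a≈b) (to (kernel b c) b≈c))

  ∼-resp-≈ : ∀ a b c d → a ≈ c → b ≈ d → a ∼ b → c ∼ d
  ∼-resp-≈ a b c d a≈c b≈d =
    from (related c d) ∘ subst₂ R (to (kernel a c) a≈c) (to (kernel b d) b≈d) ∘ to (related a b)

  Codes-functional : ∀ {u v x₁ x₂} → Codes u x₁ x₂ → Codes v x₁ x₂ → u ≡ v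
  Codes-functional cu cv = to (E-correct cu cv) (from (E-correct cu cu) refl)

  decode-surjective : ∀ w → Σ Dom λ a → decode a ≡ w
  decode-surjective w with code w
  ... | _ , _ , cw = (_ , U-complete cw) , Codes-functional (decode-codes (_ , U-complete cw)) cw

-- x₁ ≠ x₂ ∧ ∃ s (¬ s R s ∧ s R x₁ ∧ s R x₂) ∧ (∀ s (s R x₁ → s R x₂) ∨ ∀ s (s R x₂ → s R x₁))
copiesOfAWorld : Formula 2
copiesOfAWorld =
  ¬' ((# 0) ≐ (# 1))
  ∧' ∃' (¬' Rel (# 0) (# 0) ∧' Rel (# 0) (# 1) ∧' Rel (# 0) (# 2))
  ∧' (∀' (Rel (# 0) (# 1) ⇒' Rel (# 0) (# 2)) ∨' ∀' (Rel (# 0) (# 2) ⇒' Rel (# 0) (# 1)))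

sameWorld : Formula 4
sameWorld = (# 0) ≐ (# 2) ∨' (# 0) ≐ (# 3)

-- ∃ s p q (p ∈ {x₁, x₂} ∧ q ∈ {y₁, y₂} ∧ s R p ∧ s R q ∧ p ≠ q ∧ ¬ (s R x₁ ∧ s R x₂))
adjacentWorlds : Formula 4
adjacentWorlds = ∃' (∃' (∃' (
    ((# 1) ≐ (# 3) ∨' (# 1) ≐ (# 4))
  ∧' ((# 0) ≐ (# 5) ∨' (# 0) ≐ (# 6))
  ∧' Rel (# 2) (# 1) ∧' Rel (# 2) (# 0)
  ∧' ¬' ((# 1) ≐ (# 0))
  ∧' ¬' (Rel (# 2) (# 3) ∧' Rel (# 2) (# 4)))))

module DoubledGalaxy (F : Frame) (irreflexive : ∀ x → ¬ Frame.R F x x)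
                     (symmetric : ∀ x y → Frame.R F x y → Frame.R F y x) where

  open Frame F

  -- Each world gets two vertex nodes only to make |A| ≥ 4.
  data Node : Set where
    vertex : W × Bool → Node
    edge   : (x y : W) → R x y → Node

  data Sees : Node → W × Bool → Set where
    own    : ∀ {w k} l → Sees (vertex (w , k)) (w , l)
    source : ∀ {x y r} → Sees (edge x y r) (x , false)
    target : ∀ {x y r} → Sees (edge x y r) (y , false)

  G : Frame
  G = Galaxy Node (W × Bool) Sees

  open Frame G renaming (W to Point; R to _⇾_)

  pattern node n   = inj₁ n
  pattern point b  = inj₂ b
  pattern copy w k = point (w , k)

  _≼_ : Point → Point → Set
  x ≼ y = ∀ s → s ⇾ x → s ⇾ y

  data Copies (u : W) : Point → Point → Set where
    copies : ∀ {k k'} → k ≢ k' → Copies u (copy u k) (copy u k')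

  R⇒≢ : ∀ {x y} → R x y → x ≢ y
  R⇒≢ r refl = irreflexive _ r

  sees-exactly-two : ∀ n → HasExactlyTwo (Sees n)
  sees-exactly-two (vertex (w , _)) =
    (w , false) , (w , true) , (λ ()) , own false , own true ,
    λ { _ (own false) → inj₁ refl ; _ (own true) → inj₂ refl }
  sees-exactly-two (edge x y r) =
    (x , false) , (y , false) , R⇒≢ r ∘ cong proj₁ , source , target ,
    λ { _ source → inj₁ refl ; _ target → inj₂ refl }

  galaxy-∈K₂ : AtLeast 2 W → InK₂ Node (W × Bool) Sees
  galaxy-∈K₂ atLeast2 = AtLeast-map (mk↣ vertex-injective) copies₄ , copies₄ , sees-exactly-two
    where
    copies₄ : AtLeast 4 (W × Bool)
    copies₄ = AtLeast-× atLeast2 AtLeast-2-Bool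

    vertex-injective : ∀ {a b} → vertex a ≡ vertex b → a ≡ b
    vertex-injective refl = refl

  edge-sees-false : ∀ {a b r u k} → Sees (edge a b r) (u , k) → k ≡ false
  edge-sees-false source = refl
  edge-sees-false target = refl

  true-copy-≼ : ∀ {u} k → copy u true ≼ copy u k
  true-copy-≼ k (point _)         _       = tt
  true-copy-≼ k (node (vertex _)) (own _) = own k
  true-copy-≼ k (node (edge _ _ _)) ()

  ≼⇒same-world : ∀ {a b k l} → copy a k ≼ copy b l → a ≡ b
  ≼⇒same-world {a} {k = k} a≼b with a≼b (node (vertex (a , k))) (own k)
  ... | own _ = refl

  comparable⇒same-world : ∀ {a b k l} → copy a k ≼ copy b l ⊎ copy b l ≼ copy a k → a ≡ b
  comparable⇒same-world = [ ≼⇒same-world , sym ∘ ≼⇒same-world ]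

  copy-∈-Copies : ∀ {u x₁ x₂} → Copies u x₁ x₂ → ∀ k → copy u k ≡ x₁ ⊎ copy u k ≡ x₂
  copy-∈-Copies (copies k₁≢k₂) k with distinct-Bools-cover k₁≢k₂ k
  ... | inj₁ refl = inj₁ refl
  ... | inj₂ refl = inj₂ refl

  ∈-Copies⇒same-world : ∀ {u x₁ x₂ w k} →
                        Copies u x₁ x₂ → copy w k ≡ x₁ ⊎ copy w k ≡ x₂ → w ≡ u
  ∈-Copies⇒same-world (copies _) (inj₁ refl) = refl
  ∈-Copies⇒same-world (copies _) (inj₂ refl) = refl

  U-sound : ∀ x₁ x₂ → Sat G copiesOfAWorld (val2 x₁ x₂) → ∃ λ u → Copies u x₁ x₂
  U-sound _ _ (_ , (point _ , ¬s⇾s , _) , _) = ⊥-elim (¬s⇾s tt)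
  U-sound (node _) _ (_ , (node _ , _ , () , _) , _)
  U-sound (point _) (node _) (_ , (node _ , _ , _ , ()) , _)
  U-sound (point _) (point _) (x₁≢x₂ , (node (vertex (w , _)) , _ , own _ , own _) , _) =
    w , copies (x₁≢x₂ ∘ cong (λ k → copy w k))
  U-sound (point _) (point _) (x₁≢x₂ , (node (edge _ _ _) , _ , source , source) , _) =
    ⊥-elim (x₁≢x₂ refl)
  U-sound (point _) (point _) (x₁≢x₂ , (node (edge _ _ _) , _ , target , target) , _) =
    ⊥-elim (x₁≢x₂ refl)
  U-sound (point _) (point _) (_ , (node (edge _ _ r) , _ , source , target) , comparable) =
    ⊥-elim (R⇒≢ r (comparable⇒same-world comparable))
  U-sound (point _) (point _) (_ , (node (edge x y r) , _ , target , source) , comparable) =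
    ⊥-elim (R⇒≢ (symmetric x y r) (comparable⇒same-world comparable))

  U-complete : ∀ {u x₁ x₂} → Copies u x₁ x₂ → Sat G copiesOfAWorld (val2 x₁ x₂)
  U-complete {u} (copies {k} {k'} k≢k') =
    (λ { refl → k≢k' refl }) , (node (vertex (u , false)) , (λ ()) , own k , own k') , comparable
    where
    comparable : copy u k ≼ copy u k' ⊎ copy u k' ≼ copy u k
    comparable with distinct-Bools-cover k≢k' true
    ... | inj₁ refl = inj₁ (true-copy-≼ k')
    ... | inj₂ refl = inj₂ (true-copy-≼ k)

  E-correct : ∀ {u v x₁ x₂ y₁ y₂} → Copies u x₁ x₂ → Copies v y₁ y₂ →
              Sat G sameWorld (val4 x₁ x₂ y₁ y₂) ⇔ u ≡ v
  E-correct (copies {k} _) cv =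
    mk⇔ (∈-Copies⇒same-world cv) λ { refl → copy-∈-Copies cv k }

  A-sound : ∀ {u v x₁ x₂ y₁ y₂} → Copies u x₁ x₂ → Copies v y₁ y₂ →
            Sat G adjacentWorlds (val4 x₁ x₂ y₁ y₂) → R u v
  A-sound (copies _) (copies _) (point _ , _ , _ , _ , _ , _ , _ , _ , not-both) =
    ⊥-elim (not-both (tt , tt))
  A-sound (copies _) (copies _) (node (vertex _) , _ , _ , inj₁ refl , _ , own _ , _ , _ , not-both) =
    ⊥-elim (not-both (own _ , own _))
  A-sound (copies _) (copies _) (node (vertex _) , _ , _ , inj₂ refl , _ , own _ , _ , _ , not-both) =
    ⊥-elim (not-both (own _ , own _))
  A-sound _ _ (node _ , node _ , _ , _ , _ , () , _)
  A-sound _ _ (node _ , _ , node _ , _ , _ , _ , () , _)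
  A-sound _ _ (node (edge _ _ _) , point _ , point _ , _ , _ , source , source , p≢q , _) =
    ⊥-elim (p≢q refl)
  A-sound _ _ (node (edge _ _ _) , point _ , point _ , _ , _ , target , target , p≢q , _) =
    ⊥-elim (p≢q refl)
  A-sound cu cv (node (edge _ _ r) , point _ , point _ , p∈x , q∈y , source , target , _ , _) =
    subst₂ R (∈-Copies⇒same-world cu p∈x) (∈-Copies⇒same-world cv q∈y) r
  A-sound cu cv (node (edge x y r) , point _ , point _ , p∈x , q∈y , target , source , _ , _) =
    subst₂ R (∈-Copies⇒same-world cu p∈x) (∈-Copies⇒same-world cv q∈y) (symmetric x y r)

  A-complete : ∀ {u v x₁ x₂ y₁ y₂} → Copies u x₁ x₂ → Copies v y₁ y₂ →
               R u v → Sat G adjacentWorlds (val4 x₁ x₂ y₁ y₂)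
  A-complete {u} {v} cu@(copies k≢k') cv r =
    node (edge u v r) , copy u false , copy v false ,
    copy-∈-Copies cu false , copy-∈-Copies cv false , source , target ,
    (λ { refl → irreflexive u r }) ,
    λ (s₁ , s₂) → k≢k' (trans (edge-sees-false s₁) (sym (edge-sees-false s₂)))

  coding : Coding copiesOfAWorld sameWorld adjacentWorlds G F
  coding = record
    { Codes      = Copies
    ; code       = λ u → copy u false , copy u true , copies (λ ())
    ; U-sound    = U-sound
    ; U-complete = U-complete
    ; E-correct  = E-correct
    ; A-correct  = λ cu cv → mk⇔ (A-sound cu cv) (A-complete cu cv)
    }

lemma47 : RelElemDefInK₂ IrreflSymm2
lemma47 = copiesOfAWorld , sameWorld , adjacentWorlds ,
  λ F (irreflexive , symmetric , atLeast2) →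
    let open DoubledGalaxy F irreflexive symmetric in
    Node , (Frame.W F × Bool) , Sees , galaxy-∈K₂ atLeast2 ,
    Coding⇒Interprets (proj₁ atLeast2 (# 0)) coding
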